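{- For every positive integer $k$, $\beta_{k+1,k}=\frac{1}{k+1}$.
   Context: For a family of subsets of a set $X$, a hitting set is a subset $Y\subseteq X$ meeting every member of the family. For a positive integer $m$ and $k\in\{1,\dots,m\}$, $\beta_{m,k}$ is the smallest real number $\beta$ such that: for any finite set $X$ and any $m$ subsets $A_1,\dots,A_m$ of $X$ with $|A_i|>\beta|X|$ for all $i$, there is a hitting set for $\{A_1,\dots,A_m\}$ of size at most $k$.
   Formalization: The competing values of β in the definition of $\beta_{m,k}$ as a smallest number range only over the rationals rather than over all real numbers. -}

module Defs where

open import Data.Nat using (ℕ; suc; _≤_)
open import Data.Fin using (Fin)
open import Data.Fin.Subset using (Subset; _∩_; ∣_∣; Nonempty)
open import Data.Integer using (+_)
open import Data.Rational using (ℚ; _/_; _*_; _<_)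
open import Data.Product using (Σ; _×_)
open import Relation.Nullary using (¬_)

ℕtoℚ : ℕ → ℚ
ℕtoℚ n = (+ n) / 1

IsHittingSet : ∀ {m n} → (Fin m → Subset n) → Subset n → Set
IsHittingSet {m} A Y = (i : Fin m) → Nonempty (Y ∩ A i)

-- The defining property of β_{m,k} for a given β:
-- for any finite set X (w.l.o.g. X = Fin n) and any m subsets A_1..A_m of X
-- with |A_i| > β|X| for all i, there is a hitting set of size at most k.
HittingProperty : ℕ → ℕ → ℚ → Set
HittingProperty m k β =
  (n : ℕ) (A : Fin m → Subset n) →
  ((i : Fin m) → β * ℕtoℚ n < ℕtoℚ ∣ A i ∣) →
  Σ (Subset n) (λ Y → (∣ Y ∣ ≤ k) × IsHittingSet A Y)

IsBeta : ℕ → ℕ → ℚ → Set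
IsBeta m k β = HittingProperty m k β × ((β' : ℚ) → β' < β → ¬ HittingProperty m k β')

-- Upper bound: if k + 2 sets each have more than n/(k+2) of the n points, their sizes sum to
-- more than n, so by pigeonhole two of them share a point x; x together with one point from
-- each of the other k sets is a hitting set of size k + 1.  Lower bound: for β < 1/(k+2) the
-- k + 2 singletons of a (k+2)-element set are all large enough, but only the whole set hits them.
module Submission where

open import Defs
open import Data.Nat as ℕ using (ℕ; suc; zero; _+_; _*_; _≤_; _<_; z≤n; s≤s)
import Data.Nat.Properties as ℕP
open import Data.Nat.ListAction using (sum)
open import Data.List using (tabulate)
open import Data.Fin using (Fin; zero; suc; punchIn; punchOut; _≟_)
open import Data.Fin.Properties using (punchIn-punchOut; suc-injective)
open import Data.Fin.Subset
open import Data.Fin.Subset.Properties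
open import Data.Bool using (true; false)
open import Data.Vec using ([]; _∷_)
open import Data.Product using (∃; ∃₂; _×_; _,_)
open import Data.Sum using (_⊎_; inj₁; inj₂)
open import Data.Empty using (⊥-elim)
open import Function using (_∘_)
open import Relation.Nullary using (¬_; yes; no; contradiction)
open import Relation.Binary.PropositionalEquality

∣p∪q∣+∣p∩q∣≡∣p∣+∣q∣ : ∀ {n} (p q : Subset n) → ∣ p ∪ q ∣ + ∣ p ∩ q ∣ ≡ ∣ p ∣ + ∣ q ∣
∣p∪q∣+∣p∩q∣≡∣p∣+∣q∣ []          []          = refl
∣p∪q∣+∣p∩q∣≡∣p∣+∣q∣ (true ∷ p)  (true ∷ q)  = cong suc (begin
  ∣ p ∪ q ∣ + suc ∣ p ∩ q ∣   ≡⟨ ℕP.+-suc _ _ ⟩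
  suc (∣ p ∪ q ∣ + ∣ p ∩ q ∣) ≡⟨ cong suc (∣p∪q∣+∣p∩q∣≡∣p∣+∣q∣ p q) ⟩
  suc (∣ p ∣ + ∣ q ∣)         ≡⟨ ℕP.+-suc _ _ ⟨
  ∣ p ∣ + suc ∣ q ∣           ∎)
  where open ≡-Reasoning
∣p∪q∣+∣p∩q∣≡∣p∣+∣q∣ (true ∷ p)  (false ∷ q) = cong suc (∣p∪q∣+∣p∩q∣≡∣p∣+∣q∣ p q)
∣p∪q∣+∣p∩q∣≡∣p∣+∣q∣ (false ∷ p) (true ∷ q)  =
  trans (cong suc (∣p∪q∣+∣p∩q∣≡∣p∣+∣q∣ p q)) (sym (ℕP.+-suc _ _))
∣p∪q∣+∣p∩q∣≡∣p∣+∣q∣ (false ∷ p) (false ∷ q) = ∣p∪q∣+∣p∩q∣≡∣p∣+∣q∣ p q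

∣p∪q∣≤∣p∣+∣q∣ : ∀ {n} (p q : Subset n) → ∣ p ∪ q ∣ ≤ ∣ p ∣ + ∣ q ∣
∣p∪q∣≤∣p∣+∣q∣ p q = subst (∣ p ∪ q ∣ ≤_) (∣p∪q∣+∣p∩q∣≡∣p∣+∣q∣ p q) (ℕP.m≤m+n _ _)

Empty[p∩q]⇒∣p∪q∣≡∣p∣+∣q∣ : ∀ {n} (p q : Subset n) → Empty (p ∩ q) → ∣ p ∪ q ∣ ≡ ∣ p ∣ + ∣ q ∣
Empty[p∩q]⇒∣p∪q∣≡∣p∣+∣q∣ {n} p q empty = begin
  ∣ p ∪ q ∣           ≡⟨ ℕP.+-identityʳ _ ⟨
  ∣ p ∪ q ∣ + 0       ≡⟨ cong (λ r → ∣ p ∪ q ∣ + r) (∣⊥∣≡0 n) ⟨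
  ∣ p ∪ q ∣ + ∣ ⊥ {n} ∣ ≡⟨ cong (λ r → ∣ p ∪ q ∣ + ∣ r ∣) (Empty-unique empty) ⟨
  ∣ p ∪ q ∣ + ∣ p ∩ q ∣ ≡⟨ ∣p∪q∣+∣p∩q∣≡∣p∣+∣q∣ p q ⟩
  ∣ p ∣ + ∣ q ∣       ∎
  where open ≡-Reasoning

∣⁅x⁆∪p∣≤1+∣p∣ : ∀ {n} (x : Fin n) (p : Subset n) → ∣ ⁅ x ⁆ ∪ p ∣ ≤ suc ∣ p ∣
∣⁅x⁆∪p∣≤1+∣p∣ x p = subst (λ c → ∣ ⁅ x ⁆ ∪ p ∣ ≤ c + ∣ p ∣) (∣⁅x⁆∣≡1 x) (∣p∪q∣≤∣p∣+∣q∣ ⁅ x ⁆ p)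

∣p∣≢0⇒Nonempty : ∀ {n} (p : Subset n) → ∣ p ∣ ≢ 0 → Nonempty p
∣p∣≢0⇒Nonempty {n} p ∣p∣≢0 with nonempty? p
... | yes nonempty = nonempty
... | no empty = contradiction (trans (cong ∣_∣ (Empty-unique empty)) (∣⊥∣≡0 n)) ∣p∣≢0

x∈⋃⁻ : ∀ {m n} (A : Fin m → Subset n) {x} → x ∈ ⋃ (tabulate A) → ∃ λ i → x ∈ A i
x∈⋃⁻ {zero}  A x∈⋃ = ⊥-elim (∉⊥ x∈⋃)
x∈⋃⁻ {suc m} A x∈⋃ with x∈p∪q⁻ (A zero) (⋃ (tabulate (A ∘ suc))) x∈⋃
... | inj₁ x∈A₀ = zero , x∈A₀
... | inj₂ x∈⋃′ with x∈⋃⁻ (A ∘ suc) x∈⋃′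
...   | i , x∈Aᵢ = suc i , x∈Aᵢ

Overlapping : ∀ {m n} → (Fin m → Subset n) → Set
Overlapping A = ∃₂ λ i j → i ≢ j × Nonempty (A i ∩ A j)

overlapping⊎sum≤∣⋃∣ : ∀ {m n} (A : Fin m → Subset n) →
  Overlapping A ⊎ sum (tabulate (∣_∣ ∘ A)) ≤ ∣ ⋃ (tabulate A) ∣
overlapping⊎sum≤∣⋃∣ {zero}  A = inj₂ z≤n
overlapping⊎sum≤∣⋃∣ {suc m} A with overlapping⊎sum≤∣⋃∣ (A ∘ suc)
... | inj₁ (i , j , i≢j , meet) = inj₁ (suc i , suc j , i≢j ∘ suc-injective , meet)
... | inj₂ sum≤∣⋃∣ with nonempty? (A zero ∩ ⋃ (tabulate (A ∘ suc)))
...   | yes (x , x∈A₀∩⋃) =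
  let x∈A₀ , x∈⋃ = x∈p∩q⁻ (A zero) _ x∈A₀∩⋃
      j , x∈Aⱼ = x∈⋃⁻ (A ∘ suc) x∈⋃
  in inj₁ (zero , suc j , (λ ()) , x , x∈p∩q⁺ (x∈A₀ , x∈Aⱼ))
...   | no empty = inj₂ (ℕP.≤-trans (ℕP.+-monoʳ-≤ ∣ A zero ∣ sum≤∣⋃∣)
  (ℕP.≤-reflexive (sym (Empty[p∩q]⇒∣p∪q∣≡∣p∣+∣q∣ (A zero) _ empty))))

pigeonhole : ∀ {m n} (A : Fin m → Subset n) → n < sum (tabulate (∣_∣ ∘ A)) → Overlapping A
pigeonhole A n<sum with overlapping⊎sum≤∣⋃∣ A
... | inj₁ overlapping = overlapping
... | inj₂ sum≤∣⋃∣ = contradiction (ℕP.≤-trans sum≤∣⋃∣ (∣p∣≤n (⋃ (tabulate A)))) (ℕP.<⇒≱ n<sum)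

m*a≤c*sum : ∀ {m} (f : Fin m → ℕ) a c → (∀ i → a ≤ c * f i) → m * a ≤ c * sum (tabulate f)
m*a≤c*sum {zero}  f a c bound = z≤n
m*a≤c*sum {suc m} f a c bound = subst (suc m * a ≤_) (sym (ℕP.*-distribˡ-+ c (f zero) _))
  (ℕP.+-mono-≤ (bound zero) (m*a≤c*sum (f ∘ suc) a c (bound ∘ suc)))

IsHittingSet-mono : ∀ {m n} {A : Fin m → Subset n} {Y Z} → Y ⊆ Z → IsHittingSet A Y → IsHittingSet A Z
IsHittingSet-mono Y⊆Z hits i with hits i
... | y , y∈Y∩Aᵢ = let y∈Y , y∈Aᵢ = x∈p∩q⁻ _ _ y∈Y∩Aᵢ in y , x∈p∩q⁺ (Y⊆Z y∈Y , y∈Aᵢ)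

IsHittingSet-punchIn : ∀ {m n} {A : Fin (suc m) → Subset n} {Y} {x} (i : Fin (suc m)) →
  x ∈ Y → x ∈ A i → IsHittingSet (A ∘ punchIn i) Y → IsHittingSet A Y
IsHittingSet-punchIn {A = A} {x = x} i x∈Y x∈Aᵢ hits l with i ≟ l
... | yes refl = x , x∈p∩q⁺ (x∈Y , x∈Aᵢ)
... | no i≢l = subst (λ j → Nonempty (_ ∩ A j)) (punchIn-punchOut i≢l) (hits (punchOut i≢l))

IsHittingSet-insert : ∀ {m n} {A : Fin (suc m) → Subset n} {Y} {x} (i : Fin (suc m)) →
  x ∈ A i → IsHittingSet (A ∘ punchIn i) Y → IsHittingSet A (⁅ x ⁆ ∪ Y)
IsHittingSet-insert {Y = Y} {x} i x∈Aᵢ hits =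
  IsHittingSet-punchIn i (p⊆p∪q Y (x∈⁅x⁆ x)) x∈Aᵢ (IsHittingSet-mono (q⊆p∪q ⁅ x ⁆ Y) hits)

HittingSetOfSize≤ : ∀ {m n} → ℕ → (Fin m → Subset n) → Set
HittingSetOfSize≤ k A = ∃ λ Y → ∣ Y ∣ ≤ k × IsHittingSet A Y

hittingSet-of-nonempty : ∀ {m n} (A : Fin m → Subset n) → (∀ i → Nonempty (A i)) →
  HittingSetOfSize≤ m A
hittingSet-of-nonempty {zero}  {n} A nonempty = ⊥ , ℕP.≤-reflexive (∣⊥∣≡0 n) , λ ()
hittingSet-of-nonempty {suc m} A nonempty
  with nonempty zero | hittingSet-of-nonempty (A ∘ suc) (nonempty ∘ suc)
... | x , x∈A₀ | Y , ∣Y∣≤m , hits =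
  ⁅ x ⁆ ∪ Y , ℕP.≤-trans (∣⁅x⁆∪p∣≤1+∣p∣ x Y) (s≤s ∣Y∣≤m) , IsHittingSet-insert zero x∈A₀ hits

hittingSet-of-overlapping : ∀ {m n} (A : Fin (suc (suc m)) → Subset n) → (∀ i → Nonempty (A i)) →
  Overlapping A → HittingSetOfSize≤ (suc m) A
-- The sets other than A i and A j are A ∘ punchIn i ∘ punchIn (punchOut i≢j).
hittingSet-of-overlapping A nonempty (i , j , i≢j , x , x∈Aᵢ∩Aⱼ)
  with x∈p∩q⁻ (A i) (A j) x∈Aᵢ∩Aⱼ
     | hittingSet-of-nonempty (A ∘ punchIn i ∘ punchIn (punchOut i≢j))
                              (nonempty ∘ punchIn i ∘ punchIn (punchOut i≢j))
... | x∈Aᵢ , x∈Aⱼ | Y , ∣Y∣≤m , hits = ⁅ x ⁆ ∪ Y , ℕP.≤-trans (∣⁅x⁆∪p∣≤1+∣p∣ x Y) (s≤s ∣Y∣≤m) ,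
  IsHittingSet-punchIn i (p⊆p∪q Y (x∈⁅x⁆ x)) x∈Aᵢ
    (IsHittingSet-insert (punchOut i≢j) (subst (λ l → x ∈ A l) (sym (punchIn-punchOut i≢j)) x∈Aⱼ) hits)

-- Opened only from here on: ℤ's prefix +_ would make the ℕ sums above ambiguous.
open import Data.Integer as ℤ using (+_)
import Data.Integer.Properties as ℤP
open import Data.Rational as ℚ using (_/_; toℚᵘ; fromℚᵘ)
import Data.Rational.Properties as ℚP
open import Data.Rational.Unnormalised as ℚᵘ using (mkℚᵘ; ↥_; ↧_; *<*)
import Data.Rational.Unnormalised.Properties as ℚᵘP
open import Function using (_⇔_; mk⇔; Equivalence)
open import Function.Related.Propositional using (module EquationalReasoning; equivalence)

-- Both ℕtoℚ n and + 1 / suc d are definitionally fromℚᵘ of the evident unnormalised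
-- rational, so comparisons between them reduce to cross-multiplication in ℤ.
fromℚᵘ-<-⇔ : ∀ p q → fromℚᵘ p ℚ.< fromℚᵘ q ⇔ p ℚᵘ.< q
fromℚᵘ-<-⇔ p q = mk⇔
  (ℚᵘP.<-respˡ-≃ (ℚP.toℚᵘ-fromℚᵘ p) ∘ ℚᵘP.<-respʳ-≃ (ℚP.toℚᵘ-fromℚᵘ q) ∘ ℚP.toℚᵘ-mono-<)
  (ℚP.toℚᵘ-cancel-< ∘ ℚᵘP.<-respˡ-≃ (ℚᵘP.≃-sym (ℚP.toℚᵘ-fromℚᵘ p)) ∘ ℚᵘP.<-respʳ-≃ (ℚᵘP.≃-sym (ℚP.toℚᵘ-fromℚᵘ q)))

fromℚᵘ-homo-* : ∀ p q → fromℚᵘ p ℚ.* fromℚᵘ q ≡ fromℚᵘ (p ℚᵘ.* q)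
fromℚᵘ-homo-* p q = ℚP.toℚᵘ-injective (ℚᵘP.≃-trans (ℚP.toℚᵘ-homo-* (fromℚᵘ p) (fromℚᵘ q))
  (ℚᵘP.≃-trans (ℚᵘP.*-cong (ℚP.toℚᵘ-fromℚᵘ p) (ℚP.toℚᵘ-fromℚᵘ q)) (ℚᵘP.≃-sym (ℚP.toℚᵘ-fromℚᵘ (p ℚᵘ.* q)))))

*ℕtoℚ<ℕtoℚ⇔ : ∀ p n a → fromℚᵘ p ℚ.* ℕtoℚ n ℚ.< ℕtoℚ a ⇔ (↥ p) ℤ.* + n ℤ.< + a ℤ.* ↧ p
*ℕtoℚ<ℕtoℚ⇔ p@(mkℚᵘ i d) n a = begin
  fromℚᵘ p ℚ.* ℕtoℚ n ℚ.< ℕtoℚ a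
    ≡⟨ cong (ℚ._< ℕtoℚ a) (fromℚᵘ-homo-* p (mkℚᵘ (+ n) 0)) ⟩
  fromℚᵘ (p ℚᵘ.* mkℚᵘ (+ n) 0) ℚ.< ℕtoℚ a
    ∼⟨ fromℚᵘ-<-⇔ _ (mkℚᵘ (+ a) 0) ⟩
  p ℚᵘ.* mkℚᵘ (+ n) 0 ℚᵘ.< mkℚᵘ (+ a) 0
    ∼⟨ mk⇔ (λ { (*<* lt) → lt }) *<* ⟩
  (i ℤ.* + n) ℤ.* + 1 ℤ.< + a ℤ.* + suc (d ℕ.* 1)
    ≡⟨ cong₂ ℤ._<_ (ℤP.*-identityʳ _) (cong (λ e → + a ℤ.* + suc e) (ℕP.*-identityʳ d)) ⟩
  i ℤ.* + n ℤ.< + a ℤ.* + suc d ∎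
  where open EquationalReasoning {k = equivalence}

1/d*n<a⇒n<d*a : ∀ d n a → (+ 1 / suc d) ℚ.* ℕtoℚ n ℚ.< ℕtoℚ a → n ℕ.< suc d ℕ.* a
1/d*n<a⇒n<d*a d n a lt = ℤP.drop‿+<+ (subst₂ ℤ._<_ (ℤP.*-identityˡ (+ n)) +a*+d≡+[d*a] cross)
  where
  cross : + 1 ℤ.* + n ℤ.< + a ℤ.* + suc d
  cross = Equivalence.to (*ℕtoℚ<ℕtoℚ⇔ (mkℚᵘ (+ 1) d) n a) lt
  +a*+d≡+[d*a] : + a ℤ.* + suc d ≡ + (suc d ℕ.* a)
  +a*+d≡+[d*a] = trans (sym (ℤP.pos-* a (suc d))) (cong +_ (ℕP.*-comm a (suc d)))

<1/d⇒*d<1 : ∀ q d → q ℚ.< + 1 / suc d → q ℚ.* ℕtoℚ (suc d) ℚ.< ℚ.1ℚ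
<1/d⇒*d<1 q d lt = subst (λ r → r ℚ.* ℕtoℚ (suc d) ℚ.< ℚ.1ℚ) (ℚP.fromℚᵘ-toℚᵘ q)
  (Equivalence.from (*ℕtoℚ<ℕtoℚ⇔ (toℚᵘ q) (suc d) 1) cross)
  where
  cross : ↥ toℚᵘ q ℤ.* + suc d ℤ.< + 1 ℤ.* ↧ toℚᵘ q
  cross with Equivalence.to (fromℚᵘ-<-⇔ (toℚᵘ q) (mkℚᵘ (+ 1) d)) (subst (ℚ._< + 1 / suc d) (sym (ℚP.fromℚᵘ-toℚᵘ q)) lt)
  ... | *<* lt′ = lt′

singletons-hittingSet⇒n≤∣Y∣ : ∀ {n} {Y : Subset n} → IsHittingSet ⁅_⁆ Y → n ≤ ∣ Y ∣
singletons-hittingSet⇒n≤∣Y∣ {n} {Y} hits = subst (_≤ ∣ Y ∣) (∣⊤∣≡n n) (p⊆q⇒∣p∣≤∣q∣ ⊤⊆Y)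
  where
  ⊤⊆Y : ⊤ ⊆ Y
  ⊤⊆Y {x} _ with hits x
  ... | y , y∈Y∩⁅x⁆ = let y∈Y , y∈⁅x⁆ = x∈p∩q⁻ Y ⁅ x ⁆ y∈Y∩⁅x⁆ in subst (_∈ Y) (x∈⁅y⁆⇒x≡y x y∈⁅x⁆) y∈Y

hittingProperty : ∀ k → HittingProperty (suc (suc k)) (suc k) (+ 1 / suc (suc k))
hittingProperty k n A large = hittingSet-of-overlapping A nonempty (pigeonhole A n<sum)
  where
  n<[k+2]*∣A∣ : ∀ i → n < suc (suc k) * ∣ A i ∣
  n<[k+2]*∣A∣ i = 1/d*n<a⇒n<d*a (suc k) n ∣ A i ∣ (large i)
  nonempty : ∀ i → Nonempty (A i)
  nonempty i = ∣p∣≢0⇒Nonempty (A i) λ ∣Aᵢ∣≡0 →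
    ℕP.n≮0 (subst (n <_) (trans (cong (suc (suc k) *_) ∣Aᵢ∣≡0) (ℕP.*-zeroʳ (suc (suc k)))) (n<[k+2]*∣A∣ i))
  n<sum : n < sum (tabulate (∣_∣ ∘ A))
  n<sum = ℕP.*-cancelˡ-≤ (suc (suc k)) (m*a≤c*sum (∣_∣ ∘ A) (suc n) (suc (suc k)) n<[k+2]*∣A∣)

¬hittingProperty : ∀ k q → q ℚ.< + 1 / suc (suc k) → ¬ HittingProperty (suc (suc k)) (suc k) q
¬hittingProperty k q q<1/[k+2] hp with hp (suc (suc k)) ⁅_⁆ singletons-large
  where
  singletons-large : ∀ i → q ℚ.* ℕtoℚ (suc (suc k)) ℚ.< ℕtoℚ ∣ ⁅ i ⁆ ∣
  singletons-large i = subst (λ s → q ℚ.* ℕtoℚ (suc (suc k)) ℚ.< ℕtoℚ s) (sym (∣⁅x⁆∣≡1 i))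
    (<1/d⇒*d<1 q (suc k) q<1/[k+2])
... | Y , ∣Y∣≤k+1 , hits = ℕP.<-irrefl refl (ℕP.≤-trans (singletons-hittingSet⇒n≤∣Y∣ hits) ∣Y∣≤k+1)

proposition6 : (k : ℕ) → IsBeta (suc (suc k)) (suc k) ((+ 1) / suc (suc k))
proposition6 k = hittingProperty k , ¬hittingProperty k
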